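{- For every $n\geq 1$, every $q\geq 2$ and every $a\in\mathbb{Z}_q$, the subgraph of $H(n,q)$ induced by $\Gamma_a^{n,q}\cup\Gamma_{a+1}^{n,q}$ is connected.
   Context: $H(n,q)$ is the graph on $\mathbb{Z}_q^n$ in which two vertices are adjacent iff they differ in exactly one coordinate. For $a\in\mathbb{Z}_q$, $\Gamma_a^{n,q}=\{x\in\mathbb{Z}_q^n: x_1+\cdots+x_n=a\}$, with the sum and $a+1$ computed in $\mathbb{Z}_q$. -}

module Defs where

open import Data.Nat using (ℕ; zero; suc; _+_; _%_; NonZero)
open import Data.Fin using (Fin; toℕ)
open import Data.Product using (Σ; ∃; _×_)
open import Data.Sum using (_⊎_)
open import Relation.Nullary using (¬_)
open import Relation.Binary.PropositionalEquality using (_≡_)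

-- Vertices of H(n,q): words of length n over Z_q = Fin q.
Word : ℕ → ℕ → Set
Word n q = Fin n → Fin q

Adj : ∀ {n q} → Word n q → Word n q → Set
Adj {n} x y = Σ (Fin n) λ i → ¬ (x i ≡ y i) × (∀ j → ¬ (j ≡ i) → x j ≡ y j)

coordSum : ∀ {n q} → Word n q → ℕ
coordSum {zero}  x = 0
coordSum {suc n} x = toℕ (x Fin.zero) + coordSum {n} (λ i → x (Fin.suc i))

-- x ∈ Γ_b^{n,q}  where b is given as a natural number representative
-- (b is compared after reduction mod q).
InΓ : ∀ {n q} .{{_ : NonZero q}} → ℕ → Word n q → Set
InΓ {q = q} b x = coordSum x % q ≡ b % q

data WalkIn {n q} (S : Word n q → Set) : Word n q → Word n q → Set where
  here : ∀ {x} → S x → WalkIn S x x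
  step : ∀ {x y z} → S x → Adj x y → WalkIn S y z → WalkIn S x z

InducedConnected : ∀ {n q} → (Word n q → Set) → Set
InducedConnected {n} {q} S = ∀ (x y : Word n q) → S x → S y → WalkIn S x y

{-# OPTIONS --safe #-}
-- Every vertex of Γₐ ∪ Γₐ₊₁ is joined to the centre c = (a, 0, …, 0), by induction on the
-- sum t of the last n − 1 coordinates read as naturals. From Γₐ, raise the first coordinate
-- by one modulo q: this lands in Γₐ₊₁ with t unchanged, and is a genuine move because q ≥ 2.
-- From Γₐ₊₁ with t > 0, lower some nonzero later coordinate by one: this lands in Γₐ with t
-- decreased. A vertex of Γₐ₊₁ with t = 0 differs from c in the first coordinate only.
module Submission where

open import Defs
open import Algebra.Properties.CommutativeSemigroup using (xy∙z≈zy∙x)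
open import Data.Nat using (ℕ; zero; suc; _≤_; _+_; _%_; NonZero; s≤s)
open import Data.Nat.Properties
  using (+-assoc; +-comm; +-suc; +-identityʳ; +-cancelʳ-≡; suc-injective;
         m+n≡0⇒m≡0; m+n≡0⇒n≡0; +-commutativeSemigroup)
open import Data.Nat.DivMod using (%-congˡ; m%n<n; %-distribˡ-+; m%n%n≡m%n; [m+n]%n≡m%n)
open import Data.Fin using (Fin; toℕ; pred; fromℕ<)
open import Data.Fin.Properties
  using (toℕ-injective; toℕ-inject₁; toℕ-fromℕ<; pred<; <⇒≢; ¬∀⟶∃¬; _≟_)
open import Data.Vec.Functional using (_∷_; tail; updateAt)
open import Data.Vec.Functional.Properties using (updateAt-updates; updateAt-minimal)
open import Data.Sum using (_⊎_; inj₁; inj₂)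
open import Data.Product using (Σ-syntax; ∃; _×_; _,_)
open import Data.Empty using (⊥-elim)
open import Function using (_∘_)
open import Relation.Nullary using (¬_; contradiction)
open import Relation.Binary.PropositionalEquality
  using (_≡_; _≢_; refl; sym; trans; cong; cong₂; module ≡-Reasoning)

open ≡-Reasoning

infix 4 _≡_mod_

_≡_mod_ : ℕ → ℕ → (q : ℕ) .{{_ : NonZero q}} → Set
m ≡ n mod q = m % q ≡ n % q

module _ {q : ℕ} .{{_ : NonZero q}} where

  +-congˡ-mod : ∀ k {m n} → m ≡ n mod q → k + m ≡ k + n mod q
  +-congˡ-mod k {m} {n} m≡n = begin
    (k + m) % q                ≡⟨ %-distribˡ-+ k m q ⟩
    (k % q + m % q) % q        ≡⟨ cong (λ r → (k % q + r) % q) m≡n ⟩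
    (k % q + n % q) % q        ≡⟨ %-distribˡ-+ k n q ⟨
    (k + n) % q                ∎

  +-congʳ-mod : ∀ k {m n} → m ≡ n mod q → m + k ≡ n + k mod q
  +-congʳ-mod k {m} {n} m≡n = begin
    (m + k) % q   ≡⟨ %-congˡ (+-comm m k) ⟩
    (k + m) % q   ≡⟨ +-congˡ-mod k m≡n ⟩
    (k + n) % q   ≡⟨ %-congˡ (+-comm k n) ⟩
    (n + k) % q   ∎

-- From here on the modulus is a successor, so _%_ computes and Agda cannot recover m and n
-- from a goal m ≡ n mod q; they are then passed explicitly.
suc-cancel-mod : ∀ {p m n} → suc m ≡ suc n mod suc p → m ≡ n mod suc p
suc-cancel-mod {p} {m} {n} eq = begin
  m % suc p           ≡⟨ [m+n]%n≡m%n m (suc p) ⟨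
  (m + suc p) % suc p ≡⟨ %-congˡ (+-suc m p) ⟩
  (suc m + p) % suc p ≡⟨ +-congʳ-mod {suc p} p {suc m} {suc n} eq ⟩
  (suc n + p) % suc p ≡⟨ %-congˡ (+-suc n p) ⟨
  (n + suc p) % suc p ≡⟨ [m+n]%n≡m%n n (suc p) ⟩
  n % suc p           ∎

+-cancelˡ-mod : ∀ {p} k {m n} → k + m ≡ k + n mod suc p → m ≡ n mod suc p
+-cancelˡ-mod zero    eq = eq
+-cancelˡ-mod {p} (suc k) {m} {n} eq = +-cancelˡ-mod k (suc-cancel-mod {p} {k + m} {k + n} eq)

m≢1+m-mod : ∀ {r} m → ¬ (m ≡ suc m mod suc (suc r))
m≢1+m-mod {r} m eq = contradiction (+-cancelˡ-mod {suc r} m {0} {1} m+0≡m+1) λ ()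
  where
  m+0≡m+1 : m + 0 ≡ m + 1 mod suc (suc r)
  m+0≡m+1 = trans (%-congˡ (+-identityʳ m)) (trans eq (%-congˡ (+-comm 1 m)))

Adj-sym : ∀ {n q} {x y : Word n q} → Adj x y → Adj y x
Adj-sym (i , xᵢ≢yᵢ , rest≡) = i , xᵢ≢yᵢ ∘ sym , λ j j≢i → sym (rest≡ j j≢i)

updateAt-Adj : ∀ {n q} (x : Word n q) i {f : Fin q → Fin q} → f (x i) ≢ x i → Adj x (updateAt x i f)
updateAt-Adj x i fxᵢ≢xᵢ =
  i , (λ eq → fxᵢ≢xᵢ (sym (trans eq (updateAt-updates i x)))) ,
  λ j j≢i → sym (updateAt-minimal j i x j≢i)

Adj-head : ∀ {n q} {x y : Word (suc n) q} → x Fin.zero ≢ y Fin.zero →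
           (∀ j → tail x j ≡ tail y j) → Adj x y
Adj-head x₀≢y₀ tail≡ = Fin.zero , x₀≢y₀ , λ
  { Fin.zero    j≢0 → ⊥-elim (j≢0 refl)
  ; (Fin.suc j) _   → tail≡ j }

module _ {n q : ℕ} {S : Word n q → Set} where

  _◅◅_ : ∀ {x y z} → WalkIn S x y → WalkIn S y z → WalkIn S x z
  here _          ◅◅ w′ = w′
  step sx x~y w   ◅◅ w′ = step sx x~y (w ◅◅ w′)

  walk-snoc : ∀ {x y z} → WalkIn S x y → Adj y z → S z → WalkIn S x z
  walk-snoc (here sy)       y~z sz = step sy y~z (here sz)
  walk-snoc (step sx x~w w) y~z sz = step sx x~w (walk-snoc w y~z sz)

  walk-reverse : ∀ {x y} → WalkIn S x y → WalkIn S y x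
  walk-reverse (here sx)       = here sx
  walk-reverse (step sx x~w w) = walk-snoc (walk-reverse w) (Adj-sym x~w) sx

  hub⇒InducedConnected : (c : Word n q) → (∀ x → S x → WalkIn S x c) → InducedConnected S
  hub⇒InducedConnected c toHub x y sx sy = toHub x sx ◅◅ walk-reverse (toHub y sy)

coordSum-updateAt : ∀ {n q} (x : Word n q) i (f : Fin q → Fin q) →
                    coordSum (updateAt x i f) + toℕ (x i) ≡ coordSum x + toℕ (f (x i))
coordSum-updateAt {suc n} x Fin.zero f =
  xy∙z≈zy∙x +-commutativeSemigroup (toℕ (f (x Fin.zero))) (coordSum (tail x)) (toℕ (x Fin.zero))
coordSum-updateAt {suc n} x (Fin.suc i) f = begin
  x₀ + coordSum (updateAt (tail x) i f) + toℕ xᵢ   ≡⟨ +-assoc x₀ _ _ ⟩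
  x₀ + (coordSum (updateAt (tail x) i f) + toℕ xᵢ) ≡⟨ cong (x₀ +_) (coordSum-updateAt (tail x) i f) ⟩
  x₀ + (coordSum (tail x) + toℕ (f xᵢ))            ≡⟨ +-assoc x₀ _ _ ⟨
  x₀ + coordSum (tail x) + toℕ (f xᵢ)              ∎
  where
  x₀ = toℕ (x Fin.zero)
  xᵢ = x (Fin.suc i)

module _ {p : ℕ} where

  coordSum-zeros : ∀ {n} (x : Word n (suc p)) → (∀ j → x j ≡ Fin.zero) → coordSum x ≡ 0
  coordSum-zeros {zero}  x zeros = refl
  coordSum-zeros {suc n} x zeros = cong₂ _+_ (cong toℕ (zeros Fin.zero)) (coordSum-zeros (tail x) (zeros ∘ Fin.suc))

  coordSum≡0⇒zeros : ∀ {n} (x : Word n (suc p)) → coordSum x ≡ 0 → ∀ j → x j ≡ Fin.zero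
  coordSum≡0⇒zeros {suc n} x sum≡0 Fin.zero    = toℕ-injective (m+n≡0⇒m≡0 _ sum≡0)
  coordSum≡0⇒zeros {suc n} x sum≡0 (Fin.suc j) = coordSum≡0⇒zeros (tail x) (m+n≡0⇒n≡0 _ sum≡0) j

  coordSum≡suc⇒nonzero : ∀ {n m} (x : Word n (suc p)) → coordSum x ≡ suc m → ∃ λ j → x j ≢ Fin.zero
  coordSum≡suc⇒nonzero {n} x sum≡suc =
    ¬∀⟶∃¬ n (λ j → x j ≡ Fin.zero) (λ j → x j ≟ Fin.zero)
      (λ zeros → contradiction (trans (sym sum≡suc) (coordSum-zeros x zeros)) λ ())

  suc-toℕ-pred : (i : Fin (suc p)) → i ≢ Fin.zero → suc (toℕ (pred i)) ≡ toℕ i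
  suc-toℕ-pred Fin.zero    i≢0 = contradiction refl i≢0
  suc-toℕ-pred (Fin.suc i) _   = cong suc (toℕ-inject₁ i)

  coordSum-pred : ∀ {n} (x : Word n (suc p)) j → x j ≢ Fin.zero →
                  suc (coordSum (updateAt x j pred)) ≡ coordSum x
  coordSum-pred x j xⱼ≢0 = +-cancelʳ-≡ (toℕ (pred (x j))) _ _ (begin
    suc (coordSum x′) + toℕ (pred (x j)) ≡⟨ +-suc (coordSum x′) _ ⟨
    coordSum x′ + suc (toℕ (pred (x j))) ≡⟨ cong (coordSum x′ +_) (suc-toℕ-pred (x j) xⱼ≢0) ⟩
    coordSum x′ + toℕ (x j)              ≡⟨ coordSum-updateAt x j pred ⟩
    coordSum x + toℕ (pred (x j))        ∎)
    where x′ = updateAt x j pred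

module _ {r n : ℕ} (a : Fin (suc (suc r))) where

  private
    q : ℕ
    q = suc (suc r)

    A : ℕ
    A = toℕ a

  Γₐ∪Γₐ₊₁ : Word (suc n) q → Set
  Γₐ∪Γₐ₊₁ x = InΓ A x ⊎ InΓ (A + 1) x

  tailSum : Word (suc n) q → ℕ
  tailSum x = coordSum (tail x)

  centre : Word (suc n) q
  centre = a ∷ λ _ → Fin.zero

  centre-InΓ : InΓ A centre
  centre-InΓ = cong (_% q) (trans (cong (A +_) (coordSum-zeros (tail centre) λ _ → refl)) (+-identityʳ A))

  inc : Fin q → Fin q
  inc i = fromℕ< (m%n<n (suc (toℕ i)) q)

  toℕ-inc : ∀ i → toℕ (inc i) ≡ suc (toℕ i) mod q
  toℕ-inc i = trans (cong (_% q) (toℕ-fromℕ< (m%n<n (suc (toℕ i)) q))) (m%n%n≡m%n (suc (toℕ i)) q)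

  inc≢id : ∀ i → inc i ≢ i
  inc≢id i inc-i≡i = m≢1+m-mod (toℕ i) (trans (cong (_% q) (cong toℕ (sym inc-i≡i))) (toℕ-inc i))

  raise : Word (suc n) q → Word (suc n) q
  raise x = updateAt x Fin.zero inc

  raise-InΓ : ∀ (x : Word (suc n) q) → InΓ A x → InΓ (A + 1) (raise x)
  raise-InΓ x x∈Γₐ = begin
    (toℕ (inc x₀) + tailSum x) % q   ≡⟨ +-congʳ-mod (tailSum x) {toℕ (inc x₀)} {suc (toℕ x₀)} (toℕ-inc x₀) ⟩
    (suc (coordSum x)) % q           ≡⟨ +-congˡ-mod 1 {coordSum x} {A} x∈Γₐ ⟩
    (1 + A) % q                      ≡⟨ cong (_% q) (+-comm 1 A) ⟩
    (A + 1) % q                      ∎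
    where x₀ = x Fin.zero

  lower-InΓ : ∀ (x z : Word (suc n) q) → coordSum x ≡ suc (coordSum z) → InΓ (A + 1) x → InΓ A z
  lower-InΓ x z x≡1+z x∈Γₐ₊₁ =
    suc-cancel-mod {m = coordSum z} {A} (trans (cong (_% q) (sym x≡1+z)) (trans x∈Γₐ₊₁ (cong (_% q) (+-comm A 1))))

  lowerTail : ∀ {m} x → tailSum x ≡ suc m → InΓ (A + 1) x →
              Σ[ z ∈ Word (suc n) q ] Adj x z × tailSum z ≡ m × InΓ A z
  lowerTail x tail≡1+m x∈Γₐ₊₁ with coordSum≡suc⇒nonzero (tail x) tail≡1+m
  ... | j , xⱼ≢0 =
    z , updateAt-Adj x (Fin.suc j) (<⇒≢ (pred< _ xⱼ≢0)) , suc-injective (trans tail≡ tail≡1+m) ,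
    lower-InΓ x z (trans (cong (toℕ (x Fin.zero) +_) (sym tail≡)) (+-suc _ _)) x∈Γₐ₊₁
    where
    z = updateAt x (Fin.suc j) pred
    tail≡ : suc (tailSum z) ≡ tailSum x
    tail≡ = coordSum-pred (tail x) j xⱼ≢0

  Adj-centre : ∀ x → tailSum x ≡ 0 → InΓ (A + 1) x → Adj x centre
  Adj-centre x tail≡0 x∈Γₐ₊₁ = Adj-head x₀≢a (coordSum≡0⇒zeros (tail x) tail≡0)
    where
    x₀≢a : x Fin.zero ≢ a
    x₀≢a x₀≡a = m≢1+m-mod A (begin
      A % q                   ≡⟨ cong (_% q) (trans (cong₂ _+_ (cong toℕ x₀≡a) tail≡0) (+-identityʳ A)) ⟨
      coordSum x % q          ≡⟨ x∈Γₐ₊₁ ⟩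
      (A + 1) % q             ≡⟨ cong (_% q) (+-comm A 1) ⟩
      suc A % q               ∎)

  toCentre-Γₐ   : ∀ m x → tailSum x ≡ m → InΓ A x → WalkIn Γₐ∪Γₐ₊₁ x centre
  toCentre-Γₐ₊₁ : ∀ m x → tailSum x ≡ m → InΓ (A + 1) x → WalkIn Γₐ∪Γₐ₊₁ x centre

  toCentre-Γₐ m x tail≡m x∈Γₐ =
    step (inj₁ x∈Γₐ) (updateAt-Adj x Fin.zero (inc≢id (x Fin.zero)))
         (toCentre-Γₐ₊₁ m (raise x) tail≡m (raise-InΓ x x∈Γₐ))

  toCentre-Γₐ₊₁ zero x tail≡0 x∈Γₐ₊₁ =
    step (inj₂ x∈Γₐ₊₁) (Adj-centre x tail≡0 x∈Γₐ₊₁) (here (inj₁ centre-InΓ))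
  toCentre-Γₐ₊₁ (suc m) x tail≡1+m x∈Γₐ₊₁ with lowerTail x tail≡1+m x∈Γₐ₊₁
  ... | z , x~z , tail≡m , z∈Γₐ = step (inj₂ x∈Γₐ₊₁) x~z (toCentre-Γₐ m z tail≡m z∈Γₐ)

  Γₐ∪Γₐ₊₁-connected : InducedConnected Γₐ∪Γₐ₊₁
  Γₐ∪Γₐ₊₁-connected = hub⇒InducedConnected centre λ
    { x (inj₁ x∈Γₐ)   → toCentre-Γₐ   (tailSum x) x refl x∈Γₐ
    ; x (inj₂ x∈Γₐ₊₁) → toCentre-Γₐ₊₁ (tailSum x) x refl x∈Γₐ₊₁ }

lemma9 : (n q : ℕ) → 1 ≤ n → 2 ≤ q → .{{_ : NonZero q}} → (a : Fin q) →
    InducedConnected {n} {q} (λ x → InΓ (toℕ a) x ⊎ InΓ (toℕ a + 1) x)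
lemma9 (suc n) (suc (suc r)) _ _ a = Γₐ∪Γₐ₊₁-connected a
lemma9 (suc n) (suc zero) _ (s≤s ()) a
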